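{- Let $C$ and $D$ be two distinct cores. For any $U\in\mathrm{Halo}(C)$ and $W\in\mathrm{Halo}(D)$, either $U\cap W\cap T=\emptyset$ or $U^*\cap W^*\cap T=\emptyset$.
   Context: Let $G=(V,E)$ be a finite undirected graph, $T\subseteq V$ a set of terminals and $\ell\ge 0$ an integer. Standing assumptions: $T$ is $\ell$-connected in $G$ (every pair of distinct terminals is joined by $\ell$ openly disjoint paths, i.e. paths sharing only their endpoints), $|T|\ge 2\ell$, and no two terminals are adjacent in $G$. For $U\subseteq V$, let $N(U)=\{v\in V\setminus U:\exists u\in U,\ uv\in E\}$ and $U^*=V\setminus(U\cup N(U))$. A deficient set is a set $U\subseteq V$ with $U\cap T\ne\emptyset$, $U^*\cap T\neq\emptyset$ and $|N(U)|<\ell+1$. A deficient set $U$ is small if $|U\cap T|\le |U^*\cap T|$. A core is an inclusionwise minimal small deficient set. For a core $C$, $\mathrm{Halo}(C)$ is the family of all small deficient sets $U$ with $C\subseteq U$ such that no core $D\ne C$ satisfies $D\subseteq U$. -}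

module Defs where

open import Data.Nat using (ℕ; _<_; _≤_; _+_)
open import Data.Bool using (Bool; true; false; T; _∧_; not)
open import Data.Fin using (Fin)
open import Data.Fin.Subset using (Subset; _∈_; _∉_; _⊆_; _∩_; ∣_∣; Nonempty; Empty; ∁)
open import Data.Fin.Properties using (any?)
open import Data.Vec using (Vec; tabulate)
open import Data.List using (List; []; _∷_)
open import Data.List.Relation.Unary.Unique.Propositional using (Unique)
import Data.List.Membership.Propositional as LM
open import Data.Product using (Σ; ∃; _×_; _,_)
open import Relation.Nullary using (¬_; Dec; yes; no)
open import Relation.Nullary.Decidable using (⌊_⌋; _×-dec_)
open import Relation.Binary.PropositionalEquality using (_≡_; _≢_)
open import Data.Fin.Subset.Properties using (_∈?_)

record Graph (n : ℕ) : Set where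
  field
    adj   : Fin n → Fin n → Bool
    sym   : ∀ u v → adj u v ≡ adj v u
    irrefl : ∀ v → adj v v ≡ false

open Graph public

Adj : ∀ {n} → Graph n → Fin n → Fin n → Set
Adj G u v = T (adj G u v)

N : ∀ {n} → Graph n → Subset n → Subset n
N G U = tabulate λ v →
  not ⌊ v ∈? U ⌋ ∧ ⌊ any? (λ u → (u ∈? U) ×-dec Data.Bool._≟_ (adj G u v) true) ⌋

Star : ∀ {n} → Graph n → Subset n → Subset n
Star G U = ∁ (U Data.Fin.Subset.∪ N G U)

data Walk {n} (G : Graph n) : Fin n → Fin n → List (Fin n) → Set where
  here : ∀ {v} → Walk G v v []
  step : ∀ {u w t is} → Adj G u w → Walk G w t is → Walk G u t (w ∷ is)
-- Walk G s t vs : vs lists the vertices after s (ending with t when s ≠ t).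

record Path {n} (G : Graph n) (s t : Fin n) : Set where
  field
    interior : List (Fin n)
    walk     : Walk G s t (interior Data.List.++ (t ∷ []))
    simple   : Unique (s ∷ interior Data.List.++ (t ∷ []))

open Path public

OpenlyDisjoint : ∀ {n} {G : Graph n} {s t : Fin n} → Path G s t → Path G s t → Set
OpenlyDisjoint P Q = ∀ v → v LM.∈ interior P → ¬ (v LM.∈ interior Q)

LConnected : ∀ {n} → Graph n → Subset n → ℕ → Set
LConnected {n} G Tm ℓ =
  ∀ s t → s ∈ Tm → t ∈ Tm → s ≢ t →
  Σ (Fin ℓ → Path G s t) λ P → ∀ i j → i ≢ j → OpenlyDisjoint (P i) (P j)

Deficient : ∀ {n} → Graph n → Subset n → ℕ → Subset n → Set
Deficient G Tm ℓ U =
  Nonempty (U ∩ Tm) × Nonempty (Star G U ∩ Tm) × ∣ N G U ∣ < ℓ + 1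

SmallDeficient : ∀ {n} → Graph n → Subset n → ℕ → Subset n → Set
SmallDeficient G Tm ℓ U =
  Deficient G Tm ℓ U × ∣ U ∩ Tm ∣ ≤ ∣ Star G U ∩ Tm ∣

Core : ∀ {n} → Graph n → Subset n → ℕ → Subset n → Set
Core G Tm ℓ C =
  SmallDeficient G Tm ℓ C ×
  (∀ U → SmallDeficient G Tm ℓ U → U ⊆ C → U ≡ C)

Halo : ∀ {n} → Graph n → Subset n → ℕ → Subset n → Subset n → Set
Halo G Tm ℓ C U =
  SmallDeficient G Tm ℓ U × C ⊆ U ×
  (∀ D → Core G Tm ℓ D → D ≢ C → ¬ (D ⊆ U))

-- If s ∈ U ∩ W and t ∈ U* ∩ W* are terminals, then N(U ∪ W) separates s from t, so
-- |N(U ∪ W)| ≥ ℓ by ℓ-connectivity. Submodularity of |N| then gives |N(U ∩ W)| ≤ ℓ, and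
-- U ∩ W is a small deficient set (its terminal side shrinks, its opposite side grows).
-- It therefore contains a core, which lies in both U and W; but a member of Halo(C)
-- contains no core other than C, and C ≠ D.
module Submission where

open import Defs hiding (sym)
open import Data.Nat using (ℕ; zero; suc; _+_; _*_; _≤_; _<_; z≤n; s≤s)
open import Data.Nat.Properties
  using (≤-trans; +-mono-≤; +-monoʳ-≤; +-cancelʳ-≤; +-comm; +-suc; m<1+n⇒m≤n; module ≤-Reasoning)
open import Data.Nat.Induction using (<-wellFounded)
open import Data.Bool using (Bool; T; true; _≟_)
open import Data.Bool.Properties using (T-∧; T-≡)
open import Data.Fin using (Fin; zero; suc) renaming (_≟_ to _≟ᶠ_)
open import Data.Fin.Properties using (any?; 0≢1+n; suc-injective)
open import Data.Fin.Subset
  using (Subset; _∈_; _∉_; _∩_; _∪_; _⊆_; _⊂_; _-_; ∣_∣; Empty; Nonempty; inside; outside)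
open import Data.Fin.Subset.Properties
open import Data.Vec using ([]; _∷_; tabulate)
open import Data.Vec.Properties using (≡-dec; lookup∘tabulate; []=⇒lookup; lookup⇒[]=)
open import Data.List using ([]; _∷_; _++_)
open import Data.List.Relation.Unary.Any using (here; there)
import Data.List.Membership.Propositional as List
open import Data.Product using (∃-syntax; _×_; _,_; proj₁; proj₂)
open import Data.Sum using (_⊎_; inj₁; inj₂; [_,_])
open import Data.Empty using (⊥-elim)
open import Function using (_∘_)
open import Function.Bundles using (Equivalence)
open import Function.Definitions using (Injective)
open import Induction.WellFounded using (Acc; acc)
open import Relation.Nullary using (¬_; Dec; yes; no; contradiction; ¬?)
open import Relation.Nullary.Decidable
  using (_×-dec_; toWitness; fromWitness; toWitnessFalse; fromWitnessFalse; decidable-stable)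
open import Relation.Binary.PropositionalEquality
  using (_≡_; _≢_; refl; sym; trans; cong; subst; module ≡-Reasoning)

open Equivalence using (to; from)

∈tabulate⁻ : ∀ {n} {f : Fin n → Bool} {v} → v ∈ tabulate f → T (f v)
∈tabulate⁻ {f = f} {v} v∈ = from T-≡ (trans (sym (lookup∘tabulate f v)) ([]=⇒lookup v∈))

∈tabulate⁺ : ∀ {n} {f : Fin n → Bool} {v} → T (f v) → v ∈ tabulate f
∈tabulate⁺ {f = f} {v} fv = lookup⇒[]= v (tabulate f) (trans (lookup∘tabulate f v) (to T-≡ fv))

∈∩∩⁻ : ∀ {n} {p q r : Subset n} {x} → x ∈ p ∩ q ∩ r → x ∈ p × x ∈ q × x ∈ r
∈∩∩⁻ {p = p} {q} {r} x∈ with x∈p∩q⁻ p (q ∩ r) x∈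
... | x∈p , x∈qr = x∈p , x∈p∩q⁻ q r x∈qr

⊆∧≢⇒⊂ : ∀ {n} {p q : Subset n} → p ⊆ q → p ≢ q → p ⊂ q
⊆∧≢⇒⊂ {p = p} {q} p⊆q p≢q with any? (λ x → x ∈? q ×-dec ¬? (x ∈? p))
... | yes (x , x∈q , x∉p) = p⊆q , x , x∈q , x∉p
... | no ∄x = contradiction (⊆-antisym p⊆q q⊆p) p≢q
  where
  q⊆p : q ⊆ p
  q⊆p {x} x∈q = decidable-stable (x ∈? p) (λ x∉p → ∄x (x , x∈q , x∉p))

∣p∪q∣+∣p∩q∣≡∣p∣+∣q∣ : ∀ {n} (p q : Subset n) → ∣ p ∪ q ∣ + ∣ p ∩ q ∣ ≡ ∣ p ∣ + ∣ q ∣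
∣p∪q∣+∣p∩q∣≡∣p∣+∣q∣ []            []            = refl
∣p∪q∣+∣p∩q∣≡∣p∣+∣q∣ (outside ∷ p) (outside ∷ q) = ∣p∪q∣+∣p∩q∣≡∣p∣+∣q∣ p q
∣p∪q∣+∣p∩q∣≡∣p∣+∣q∣ (outside ∷ p) (inside  ∷ q) =
  trans (cong suc (∣p∪q∣+∣p∩q∣≡∣p∣+∣q∣ p q)) (sym (+-suc ∣ p ∣ ∣ q ∣))
∣p∪q∣+∣p∩q∣≡∣p∣+∣q∣ (inside  ∷ p) (outside ∷ q) = cong suc (∣p∪q∣+∣p∩q∣≡∣p∣+∣q∣ p q)
∣p∪q∣+∣p∩q∣≡∣p∣+∣q∣ (inside  ∷ p) (inside  ∷ q) = cong suc (begin
  ∣ p ∪ q ∣ + suc ∣ p ∩ q ∣   ≡⟨ +-suc ∣ p ∪ q ∣ ∣ p ∩ q ∣ ⟩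
  suc (∣ p ∪ q ∣ + ∣ p ∩ q ∣) ≡⟨ cong suc (∣p∪q∣+∣p∩q∣≡∣p∣+∣q∣ p q) ⟩
  suc (∣ p ∣ + ∣ q ∣)         ≡⟨ sym (+-suc ∣ p ∣ ∣ q ∣) ⟩
  ∣ p ∣ + suc ∣ q ∣           ∎)
  where open ≡-Reasoning

p∩q⊆r∩s∧p∪q⊆r∪s⇒∣p∣+∣q∣≤∣r∣+∣s∣ : ∀ {n} {p q r s : Subset n} →
  p ∩ q ⊆ r ∩ s → p ∪ q ⊆ r ∪ s → ∣ p ∣ + ∣ q ∣ ≤ ∣ r ∣ + ∣ s ∣
p∩q⊆r∩s∧p∪q⊆r∪s⇒∣p∣+∣q∣≤∣r∣+∣s∣ {p = p} {q} {r} {s} ∩⊆ ∪⊆ = begin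
  ∣ p ∣ + ∣ q ∣           ≡⟨ sym (∣p∪q∣+∣p∩q∣≡∣p∣+∣q∣ p q) ⟩
  ∣ p ∪ q ∣ + ∣ p ∩ q ∣   ≤⟨ +-mono-≤ (p⊆q⇒∣p∣≤∣q∣ ∪⊆) (p⊆q⇒∣p∣≤∣q∣ ∩⊆) ⟩
  ∣ r ∪ s ∣ + ∣ r ∩ s ∣   ≡⟨ ∣p∪q∣+∣p∩q∣≡∣p∣+∣q∣ r s ⟩
  ∣ r ∣ + ∣ s ∣           ∎
  where open ≤-Reasoning

injective⇒≤∣p∣ : ∀ {k n} {p : Subset n} (f : Fin k → Fin n) →
  Injective _≡_ _≡_ f → (∀ i → f i ∈ p) → k ≤ ∣ p ∣
injective⇒≤∣p∣ {zero}  f inj f∈p = z≤n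
injective⇒≤∣p∣ {suc k} {p = p} f inj f∈p = ≤-trans (s≤s rest) (x∈p⇒∣p-x∣<∣p∣ (f∈p zero))
  where
  rest : k ≤ ∣ p - f zero ∣
  rest = injective⇒≤∣p∣ {p = p - f zero} (f ∘ suc) (suc-injective ∘ inj)
           (λ i → x∈p∧x≢y⇒x∈p-y (f∈p (suc i)) (0≢1+n ∘ sym ∘ inj))

m<n+1⇒m≤n : ∀ {m n} → m < n + 1 → m ≤ n
m<n+1⇒m≤n {m} {n} m<n+1 = m<1+n⇒m≤n (subst (m <_) (+-comm n 1) m<n+1)

m≤n⇒m<n+1 : ∀ {m n} → m ≤ n → m < n + 1
m≤n⇒m<n+1 {m} {n} m≤n = subst (m <_) (+-comm 1 n) (s≤s m≤n)

∩-monoˡ-⊆ : ∀ {n} {p q : Subset n} r → p ⊆ q → p ∩ r ⊆ q ∩ r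
∩-monoˡ-⊆ {p = p} r p⊆q x∈ with x∈p∩q⁻ p r x∈
... | x∈p , x∈r = x∈p∩q⁺ (p⊆q x∈p , x∈r)

module _ {n} (G : Graph n) where

  adjacent-from? : ∀ U v → Dec (∃[ u ] u ∈ U × adj G u v ≡ true)
  adjacent-from? U v = any? (λ u → (u ∈? U) ×-dec (adj G u v ≟ true))

  ∈N⁻ : ∀ {U v} → v ∈ N G U → v ∉ U × ∃[ u ] u ∈ U × Adj G u v
  ∈N⁻ {U} {v} v∈ with to T-∧ (∈tabulate⁻ v∈)
  ... | v∉U , ∃u with toWitness {a? = adjacent-from? U v} ∃u
  ...   | u , u∈U , uv = toWitnessFalse v∉U , u , u∈U , from T-≡ uv

  ∈N⁺ : ∀ {U u v} → u ∈ U → Adj G u v → v ∉ U → v ∈ N G U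
  ∈N⁺ {U} {u} {v} u∈U uv v∉U = ∈tabulate⁺ (from T-∧
    (fromWitnessFalse {a? = v ∈? U} v∉U , fromWitness {a? = adjacent-from? U v} (u , u∈U , to T-≡ uv)))

  ∈Star⁻ : ∀ {U v} → v ∈ Star G U → v ∉ U × v ∉ N G U
  ∈Star⁻ v∈ = x∈∁p⇒x∉p v∈ ∘ x∈p∪q⁺ ∘ inj₁ , x∈∁p⇒x∉p v∈ ∘ x∈p∪q⁺ ∘ inj₂

  ∈Star⁺ : ∀ {U v} → v ∉ U → v ∉ N G U → v ∈ Star G U
  ∈Star⁺ {U} v∉U v∉NU = x∉p⇒x∈∁p λ v∈ → [ v∉U , v∉NU ] (x∈p∪q⁻ U (N G U) v∈)

  Star-antitone : ∀ {X U} → X ⊆ U → Star G U ⊆ Star G X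
  Star-antitone X⊆U v∈ with ∈Star⁻ v∈
  ... | v∉U , v∉NU = ∈Star⁺ (v∉U ∘ X⊆U) λ v∈NX →
    let _ , u , u∈X , uv = ∈N⁻ v∈NX in v∉NU (∈N⁺ (X⊆U u∈X) uv v∉U)

  Star∩Star⊆Star∪ : ∀ U W → Star G U ∩ Star G W ⊆ Star G (U ∪ W)
  Star∩Star⊆Star∪ U W v∈ with x∈p∩q⁻ (Star G U) (Star G W) v∈
  ... | v∈U* , v∈W* with ∈Star⁻ v∈U* | ∈Star⁻ v∈W*
  ...   | v∉U , v∉NU | v∉W , v∉NW = ∈Star⁺ v∉U∪W v∉N[U∪W]
    where
    v∉U∪W : _ ∉ U ∪ W
    v∉U∪W v∈U∪W = [ v∉U , v∉W ] (x∈p∪q⁻ U W v∈U∪W)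
    v∉N[U∪W] : _ ∉ N G (U ∪ W)
    v∉N[U∪W] v∈N with ∈N⁻ v∈N
    ... | _ , u , u∈U∪W , uv with x∈p∪q⁻ U W u∈U∪W
    ...   | inj₁ u∈U = v∉NU (∈N⁺ u∈U uv v∉U)
    ...   | inj₂ u∈W = v∉NW (∈N⁺ u∈W uv v∉W)

  N∩∩N∪⊆N∩N : ∀ U W → N G (U ∩ W) ∩ N G (U ∪ W) ⊆ N G U ∩ N G W
  N∩∩N∪⊆N∩N U W v∈ with x∈p∩q⁻ (N G (U ∩ W)) _ v∈
  ... | v∈N∩ , v∈N∪ with ∈N⁻ v∈N∩ | ∈N⁻ v∈N∪
  ...   | _ , u , u∈U∩W , uv | v∉U∪W , _ with x∈p∩q⁻ U W u∈U∩W
  ...     | u∈U , u∈W = x∈p∩q⁺ ( ∈N⁺ u∈U uv (v∉U∪W ∘ x∈p∪q⁺ ∘ inj₁)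
                               , ∈N⁺ u∈W uv (v∉U∪W ∘ x∈p∪q⁺ ∘ inj₂))

  N∩∪N∪⊆N∪N : ∀ U W → N G (U ∩ W) ∪ N G (U ∪ W) ⊆ N G U ∪ N G W
  N∩∪N∪⊆N∪N U W v∈ = x∈p∪q⁺ ([ from-N∩ , from-N∪ ] (x∈p∪q⁻ (N G (U ∩ W)) _ v∈))
    where
    from-N∩ : ∀ {v} → v ∈ N G (U ∩ W) → v ∈ N G U ⊎ v ∈ N G W
    from-N∩ {v} v∈N with ∈N⁻ v∈N
    ... | v∉U∩W , u , u∈U∩W , uv with x∈p∩q⁻ U W u∈U∩W | v ∈? U
    ...   | u∈U , _   | no v∉U  = inj₁ (∈N⁺ u∈U uv v∉U)
    ...   | _   , u∈W | yes v∈U = inj₂ (∈N⁺ u∈W uv (v∉U∩W ∘ x∈p∩q⁺ ∘ (v∈U ,_)))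
    from-N∪ : ∀ {v} → v ∈ N G (U ∪ W) → v ∈ N G U ⊎ v ∈ N G W
    from-N∪ v∈N with ∈N⁻ v∈N
    ... | v∉U∪W , u , u∈U∪W , uv with x∈p∪q⁻ U W u∈U∪W
    ...   | inj₁ u∈U = inj₁ (∈N⁺ u∈U uv (v∉U∪W ∘ x∈p∪q⁺ ∘ inj₁))
    ...   | inj₂ u∈W = inj₂ (∈N⁺ u∈W uv (v∉U∪W ∘ x∈p∪q⁺ ∘ inj₂))

  ∣N∣-submodular : ∀ U W → ∣ N G (U ∩ W) ∣ + ∣ N G (U ∪ W) ∣ ≤ ∣ N G U ∣ + ∣ N G W ∣
  ∣N∣-submodular U W =
    p∩q⊆r∩s∧p∪q⊆r∪s⇒∣p∣+∣q∣≤∣r∣+∣s∣ (N∩∩N∪⊆N∩N U W) (N∩∪N∪⊆N∪N U W)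

  walk-out-meets-N : ∀ {X u t} is → Walk G u t (is ++ t ∷ []) → u ∈ X → t ∈ Star G X →
    ∃[ v ] v List.∈ is × v ∈ N G X
  walk-out-meets-N []       (step ut here) u∈X t∈X* with ∈Star⁻ t∈X*
  ... | t∉X , t∉NX = contradiction (∈N⁺ u∈X ut t∉X) t∉NX
  walk-out-meets-N {X} (w ∷ is) (step uw rest) u∈X t∈X* with w ∈? X
  ... | no w∉X  = w , here refl , ∈N⁺ u∈X uw w∉X
  ... | yes w∈X with walk-out-meets-N is rest w∈X t∈X*
  ...   | v , v∈is , v∈NX = v , there v∈is , v∈NX

module _ {n} (G : Graph n) (Tm : Subset n) (ℓ : ℕ) where

  LConnected⇒ℓ≤∣N∣ : LConnected G Tm ℓ → ∀ {Y} →
    Nonempty (Y ∩ Tm) → Nonempty (Star G Y ∩ Tm) → ℓ ≤ ∣ N G Y ∣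
  LConnected⇒ℓ≤∣N∣ conn {Y} (s , s∈) (t , t∈) with x∈p∩q⁻ Y Tm s∈ | x∈p∩q⁻ (Star G Y) Tm t∈
  ... | s∈Y , s∈T | t∈Y* , t∈T
    with conn s t s∈T t∈T (λ { refl → proj₁ (∈Star⁻ G t∈Y*) s∈Y })
  ...   | P , disjoint = injective⇒≤∣p∣ (proj₁ ∘ crossing) injective (proj₂ ∘ proj₂ ∘ crossing)
    where
    crossing : ∀ i → ∃[ v ] v List.∈ interior (P i) × v ∈ N G Y
    crossing i = walk-out-meets-N G (interior (P i)) (walk (P i)) s∈Y t∈Y*
    injective : Injective _≡_ _≡_ (proj₁ ∘ crossing)
    injective {i} {j} same = decidable-stable (i ≟ᶠ j) λ i≢j →
      disjoint i j i≢j _ (proj₁ (proj₂ (crossing i)))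
        (subst (List._∈ interior (P j)) (sym same) (proj₁ (proj₂ (crossing j))))

  ∩-smallDeficient : LConnected G Tm ℓ → ∀ {U W} →
    SmallDeficient G Tm ℓ U → Deficient G Tm ℓ W →
    Nonempty (U ∩ W ∩ Tm) → Nonempty (Star G U ∩ Star G W ∩ Tm) →
    SmallDeficient G Tm ℓ (U ∩ W)
  ∩-smallDeficient conn {U} {W} ((_ , _ , ∣NU∣<) , U-small) (_ , _ , ∣NW∣<) (s , s∈) (t , t∈)
    with ∈∩∩⁻ s∈ | ∈∩∩⁻ t∈
  ... | s∈U , s∈W , s∈T | t∈U* , t∈W* , t∈T =
    ( (s , x∈p∩q⁺ (x∈p∩q⁺ (s∈U , s∈W) , s∈T))
    , (t , x∈p∩q⁺ (Star-antitone G U∩W⊆U t∈U* , t∈T))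
    , m≤n⇒m<n+1 ∣N[U∩W]∣≤ℓ )
    , U∩W-small
    where
    U∩W⊆U : U ∩ W ⊆ U
    U∩W⊆U = p∩q⊆p U W

    ℓ≤∣N[U∪W]∣ : ℓ ≤ ∣ N G (U ∪ W) ∣
    ℓ≤∣N[U∪W]∣ = LConnected⇒ℓ≤∣N∣ conn
      (s , x∈p∩q⁺ (x∈p∪q⁺ (inj₁ s∈U) , s∈T))
      (t , x∈p∩q⁺ (Star∩Star⊆Star∪ G U W (x∈p∩q⁺ (t∈U* , t∈W*)) , t∈T))

    ∣N[U∩W]∣≤ℓ : ∣ N G (U ∩ W) ∣ ≤ ℓ
    ∣N[U∩W]∣≤ℓ = +-cancelʳ-≤ ℓ _ ℓ (begin
      ∣ N G (U ∩ W) ∣ + ℓ                  ≤⟨ +-monoʳ-≤ ∣ N G (U ∩ W) ∣ ℓ≤∣N[U∪W]∣ ⟩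
      ∣ N G (U ∩ W) ∣ + ∣ N G (U ∪ W) ∣    ≤⟨ ∣N∣-submodular G U W ⟩
      ∣ N G U ∣ + ∣ N G W ∣                ≤⟨ +-mono-≤ (m<n+1⇒m≤n ∣NU∣<) (m<n+1⇒m≤n ∣NW∣<) ⟩
      ℓ + ℓ                                ∎)
      where open ≤-Reasoning

    U∩W-small : ∣ (U ∩ W) ∩ Tm ∣ ≤ ∣ Star G (U ∩ W) ∩ Tm ∣
    U∩W-small = begin
      ∣ (U ∩ W) ∩ Tm ∣           ≤⟨ p⊆q⇒∣p∣≤∣q∣ (∩-monoˡ-⊆ Tm U∩W⊆U) ⟩
      ∣ U ∩ Tm ∣                 ≤⟨ U-small ⟩
      ∣ Star G U ∩ Tm ∣          ≤⟨ p⊆q⇒∣p∣≤∣q∣ (∩-monoˡ-⊆ Tm (Star-antitone G U∩W⊆U)) ⟩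
      ∣ Star G (U ∩ W) ∩ Tm ∣    ∎
      where open ≤-Reasoning

  -- Stated doubly negated so that the descent to a minimal set needs no decision
  -- procedure for SmallDeficient.
  ¬¬-contains-core : ∀ {Z} → SmallDeficient G Tm ℓ Z → ¬ ¬ (∃[ D ] Core G Tm ℓ D × D ⊆ Z)
  ¬¬-contains-core {Z} = descend (<-wellFounded ∣ Z ∣)
    where
    descend : ∀ {Z} → Acc _<_ ∣ Z ∣ → SmallDeficient G Tm ℓ Z →
      ¬ ¬ (∃[ D ] Core G Tm ℓ D × D ⊆ Z)
    descend {Z} (acc smaller) Z-sd no-core = no-core (Z , (Z-sd , minimal) , ⊆-refl)
      where
      minimal : ∀ V → SmallDeficient G Tm ℓ V → V ⊆ Z → V ≡ Z
      minimal V V-sd V⊆Z = decidable-stable (≡-dec _≟_ V Z) λ V≢Z →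
        descend (smaller (p⊂q⇒∣p∣<∣q∣ (⊆∧≢⇒⊂ V⊆Z V≢Z))) V-sd
          λ (D , D-core , D⊆V) → no-core (D , D-core , ⊆-trans D⊆V V⊆Z)

  Halo-no-common-core : ∀ {C D U W} → Halo G Tm ℓ C U → Halo G Tm ℓ D W → C ≢ D →
    ¬ (∃[ E ] Core G Tm ℓ E × E ⊆ U ∩ W)
  Halo-no-common-core {U = U} {W} (_ , _ , only-C) (_ , _ , only-D) C≢D (E , E-core , E⊆U∩W) =
    only-C E E-core
      (λ E≡C → only-D E E-core (λ E≡D → C≢D (trans (sym E≡C) E≡D)) (⊆-trans E⊆U∩W (p∩q⊆q U W)))
      (⊆-trans E⊆U∩W (p∩q⊆p U W))

lemma8 : ∀ {n} (G : Graph n) (Tm : Subset n) (ℓ : ℕ) →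
    LConnected G Tm ℓ → 2 * ℓ ≤ ∣ Tm ∣ →
    (∀ s t → s ∈ Tm → t ∈ Tm → ¬ Adj G s t) →
    ∀ C D → Core G Tm ℓ C → Core G Tm ℓ D → C ≢ D →
    ∀ U W → Halo G Tm ℓ C U → Halo G Tm ℓ D W →
    Empty (U ∩ W ∩ Tm) ⊎ Empty (Star G U ∩ Star G W ∩ Tm)
lemma8 G Tm ℓ conn _ _ C D _ _ C≢D U W U∈Halo W∈Halo
  with nonempty? (U ∩ W ∩ Tm) | nonempty? (Star G U ∩ Star G W ∩ Tm)
... | no ∄s | _     = inj₁ ∄s
... | yes _ | no ∄t = inj₂ ∄t
... | yes s | yes t =
  ⊥-elim (¬¬-contains-core G Tm ℓ U∩W-sd (Halo-no-common-core G Tm ℓ U∈Halo W∈Halo C≢D))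
  where
  U∩W-sd : SmallDeficient G Tm ℓ (U ∩ W)
  U∩W-sd = ∩-smallDeficient G Tm ℓ conn (proj₁ U∈Halo) (proj₁ (proj₁ W∈Halo)) s t
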